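{- Let $u\in L_{\mathrm{up}}$ be an up-link and let $(\ell_1, \ell_2)\in A_u$. Let $e\in E$ be the last edge of the $r$-$\mathrm{apex}(\ell_2)$ path in $G$. Then $u$ covers $e$, i.e., $e\in P_u$.
   Context: Let $G=(V,E)$ be a tree with links $L\subseteq\binom{V}{2}$, and fix a root $r\in V$. For a link $\ell$, $P_\ell$ is the edge set of the path in $G$ between its endpoints and $V_\ell$ its vertex set; $\ell$ covers the edges in $P_\ell$. $z$ is an ancestor of $v$ if $z$ lies on the $r$-$v$ path (including $r,v$); descendant is the converse. $\mathrm{apex}(\ell)$ is the vertex of $V_\ell$ closest to $r$. An up-link is a link $\{t,b\}$ with $t$ an ancestor of $b$; $L_{\mathrm{up}}$ is the set of up-links. Let $F\subseteq L$ satisfy $\bigcup_{\ell\in F}P_\ell=E$. For $v\in V$ let $B_v=\{\ell\in F\colon \mathrm{apex}(\ell)\text{ is a descendant of }v\}$. For $u=\{t,b\}\in L_{\mathrm{up}}$ with $t$ an ancestor of $b$, let $v_u$ be the ancestor of $t$ farthest from $r$ with $P_u\subseteq\bigcup_{\ell\in B_{v_u}}P_\ell$, and let $F_u\subseteq B_{v_u}$ be a fixed inclusion-wise minimal set with $P_u\subseteq\bigcup_{\ell\in F_u}P_\ell$. For $\ell\in F_u$, $P_{u,\ell}:=P_u\setminus\bigcup_{\bar\ell\in F_u\setminus\{\ell\}}P_{\bar\ell}$; these are nonempty, pairwise disjoint edge sets of subpaths of the $t$-$b$ path. Define $\ell_1\prec_u\ell_2$ iff the edges of $P_{u,\ell_1}$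 appear before those of $P_{u,\ell_2}$ on the $t$-$b$ path. If $\ell_1\prec_u\cdots\prec_u\ell_q$ are the links of $F_u$, then $A_u:=\{(\ell_i,\ell_{i+1})\colon i=1,\dots,q-1\}$. -}

module Defs where

open import Data.Nat using (ℕ; zero; suc; _≤_; _<_)
open import Data.Fin using (Fin)
open import Data.Product using (Σ; ∃; ∃-syntax; _×_; _,_; proj₁; proj₂)
open import Data.Sum using (_⊎_)
open import Relation.Nullary using (¬_)
open import Relation.Binary.PropositionalEquality using (_≡_; _≢_)

-- A tree on the vertex set Fin n, rooted at `root`, given by parent pointers.
-- Its edges are {v , parent v} for v ≢ root; the depth function certifies
-- acyclicity (every vertex reaches the root), so this is exactly a rooted tree.
-- An edge {v , parent v} is identified with its lower endpoint v (v ≢ root).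
record RootedTree (n : ℕ) : Set where
  field
    root         : Fin n
    parent       : Fin n → Fin n
    depth        : Fin n → ℕ
    parent-root  : parent root ≡ root
    depth-root   : depth root ≡ 0
    depth-parent : ∀ v → v ≢ root → depth v ≡ suc (depth (parent v))

-- A link is a pair of vertices (the unordered pair {a , b}).
Link : ℕ → Set
Link n = Fin n × Fin n

LinkSet : ℕ → Set₁
LinkSet n = Link n → Set

module _ {n : ℕ} (T : RootedTree n) where
  open RootedTree T

  iter : ℕ → Fin n → Fin n
  iter zero    v = v
  iter (suc k) v = iter k (parent v)

  Anc : Fin n → Fin n → Set
  Anc z v = ∃[ k ] (iter k v ≡ z)

  -- The edge w (= {w , parent w}, w ≢ root) lies on the tree path between
  -- the endpoints a, b of ℓ: exactly one of a, b lies in the subtree of w.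
  OnPath : Link n → Fin n → Set
  OnPath (a , b) w = (Anc w a × ¬ Anc w b) ⊎ (¬ Anc w a × Anc w b)

  InV : Link n → Fin n → Set
  InV ℓ x = (x ≡ proj₁ ℓ) ⊎ (∃[ w ] (OnPath ℓ w × ((x ≡ w) ⊎ (x ≡ parent w))))

  IsApex : Link n → Fin n → Set
  IsApex ℓ x = InV ℓ x × (∀ y → InV ℓ y → depth x ≤ depth y)

  CoversTree : LinkSet n → Set
  CoversTree F = ∀ w → w ≢ root → ∃[ ℓ ] (F ℓ × OnPath ℓ w)

  CoversPath : LinkSet n → Link n → Set
  CoversPath S u = ∀ w → OnPath u w → ∃[ ℓ ] (S ℓ × OnPath ℓ w)

  B : LinkSet n → Fin n → LinkSet n
  B F v ℓ = F ℓ × ∃[ x ] (IsApex ℓ x × Anc v x)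

  IsVu : LinkSet n → Fin n → Fin n → Fin n → Set
  IsVu F t b v =
    Anc v t × CoversPath (B F v) (t , b) ×
    (∀ z → Anc z t → CoversPath (B F z) (t , b) → depth z ≤ depth v)

  IsFu : LinkSet n → Fin n → Fin n → Fin n → LinkSet n → Set₁
  IsFu F t b v Fu =
    (∀ ℓ → Fu ℓ → B F v ℓ) × CoversPath Fu (t , b) ×
    (∀ (S : LinkSet n) → (∀ ℓ → S ℓ → Fu ℓ) → CoversPath S (t , b) →
       ∀ ℓ → Fu ℓ → S ℓ)

  Private : LinkSet n → Link n → Link n → Fin n → Set
  Private Fu u ℓ w = OnPath u w × (∀ ℓ' → Fu ℓ' → ℓ' ≢ ℓ → ¬ OnPath ℓ' w)

  -- ℓ₁ ≺_u ℓ₂: the edges of P_{u,ℓ₁} appear before those of P_{u,ℓ₂} on the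
  -- t–b path (edges on this vertical path are ordered by depth from t)
  Prec : LinkSet n → Link n → Link n → Link n → Set
  Prec Fu u ℓ₁ ℓ₂ =
    ∀ e₁ e₂ → Private Fu u ℓ₁ e₁ → Private Fu u ℓ₂ e₂ → depth e₁ < depth e₂

  -- (ℓ₁ , ℓ₂) ∈ A_u: consecutive links of Fu in the order ≺_u
  InA : LinkSet n → Link n → Link n → Link n → Set
  InA Fu u ℓ₁ ℓ₂ =
    Fu ℓ₁ × Fu ℓ₂ × Prec Fu u ℓ₁ ℓ₂ ×
    (∀ ℓ → Fu ℓ → ¬ (Prec Fu u ℓ₁ ℓ × Prec Fu u ℓ ℓ₂))

module Submission where

-- By minimality of F_u, ℓ₁ and ℓ₂ have private edges e₁ and e₂ on the vertical
-- path from t down to b, with e₁ above e₂ since ℓ₁ ≺_u ℓ₂. The apex of ℓ₂ is above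
-- e₂ ∈ P_ℓ₂, hence above b. The edge e₁ is above e₂ but not on P_ℓ₂, so it lies
-- above both ends of ℓ₂ and hence above its apex; were the apex above t, so would
-- be e₁, which is impossible for an edge of P_u. Private edges exist only up to double negation, which suffices
-- because ancestry is decidable.

open import Defs
open import Data.Fin using (Fin; zero; suc)
open import Data.Fin.Properties using (_≟_)
open import Data.Nat using (ℕ; zero; suc; _+_; _∸_; _≤_; _<_; s≤s; _≤?_)
open import Data.Nat.Properties
  using (≤-refl; ≤-total; ≰⇒≥; <⇒≱; <-irrefl; n<1+n; m∸n≤m; m≤n⇒m∸n≡0; m≤n⇒∃[o]m+o≡n; anyUpTo?)
open import Data.Product using (_×_; _,_; proj₁; proj₂; ∃; ∃-syntax)
open import Data.Product.Properties using (≡-dec)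
open import Data.Sum using (_⊎_; inj₁; inj₂)
open import Data.Empty using (⊥-elim)
open import Relation.Nullary using (¬_; Dec; yes; no)
open import Relation.Nullary.Decidable using (map′; decidable-stable)
open import Relation.Nullary.Negation using (¬¬-map)
open import Relation.Binary.PropositionalEquality
  using (_≡_; _≢_; refl; sym; trans; subst; ≢-sym)

¬¬-∀-Fin : ∀ {m} {P : Fin m → Set} → (∀ i → ¬ ¬ P i) → ¬ ¬ (∀ i → P i)
¬¬-∀-Fin {zero}  _     k = k λ ()
¬¬-∀-Fin {suc m} ¬¬P k =
  ¬¬P zero λ P0 → ¬¬-∀-Fin (λ i → ¬¬P (suc i)) λ Psuc →
    k λ { zero → P0 ; (suc i) → Psuc i }

¬¬-→ : {A B : Set} → (A → ¬ ¬ B) → ¬ ¬ (A → B)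
¬¬-→ f k = k λ a → ⊥-elim (f a λ b → k λ _ → b)

module _ {n : ℕ} (T : RootedTree n) where
  open RootedTree T

  iter-root : ∀ k → iter T k root ≡ root
  iter-root zero = refl
  iter-root (suc k) rewrite parent-root = iter-root k

  depth-iter : ∀ k v → depth (iter T k v) ≡ depth v ∸ k
  depth-iter zero    v = refl
  depth-iter (suc k) v with v ≟ root
  ... | yes refl rewrite parent-root | iter-root k | depth-root = refl
  ... | no v≢root rewrite depth-parent v v≢root = depth-iter k (parent v)

  depth≡0⇒≡root : ∀ {v} → depth v ≡ 0 → v ≡ root
  depth≡0⇒≡root {v} d≡0 with v ≟ root
  ... | yes v≡root = v≡root
  ... | no v≢root with trans (sym (depth-parent v v≢root)) d≡0
  ... | ()

  iter-+ : ∀ j k v → iter T (j + k) v ≡ iter T k (iter T j v)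
  iter-+ zero    k v = refl
  iter-+ (suc j) k v = iter-+ j k (parent v)

  iter-≥depth : ∀ {k} v → depth v ≤ k → iter T k v ≡ root
  iter-≥depth {k} v d≤k = depth≡0⇒≡root (trans (depth-iter k v) (m≤n⇒m∸n≡0 d≤k))

  Anc-refl : ∀ {v} → Anc T v v
  Anc-refl = 0 , refl

  Anc-trans : ∀ {x y z} → Anc T x y → Anc T y z → Anc T x z
  Anc-trans {z = z} (j , refl) (k , refl) = k + j , iter-+ k j z

  Anc-parent : ∀ v → Anc T (parent v) v
  Anc-parent v = 1 , refl

  Anc-root : ∀ v → Anc T root v
  Anc-root v = depth v , iter-≥depth v ≤-refl

  Anc⇒depth-≤ : ∀ {z v} → Anc T z v → depth z ≤ depth v
  Anc⇒depth-≤ {v = v} (k , refl) rewrite depth-iter k v = m∸n≤m (depth v) k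

  Anc-≢⇒Anc-parent : ∀ {y v} → Anc T y v → y ≢ v → Anc T y (parent v)
  Anc-≢⇒Anc-parent (zero  , y≡v) y≢v = ⊥-elim (y≢v (sym y≡v))
  Anc-≢⇒Anc-parent (suc k , e)   _   = k , e

  Anc-comparable : ∀ {p q v} → Anc T p v → Anc T q v → Anc T p q ⊎ Anc T q p
  Anc-comparable {v = v} (i , refl) (j , refl) with ≤-total i j
  ... | inj₁ i≤j with d , refl ← m≤n⇒∃[o]m+o≡n i≤j = inj₂ (d , sym (iter-+ i d v))
  ... | inj₂ j≤i with d , refl ← m≤n⇒∃[o]m+o≡n j≤i = inj₁ (d , sym (iter-+ j d v))

  -- Beyond depth v every iterate is the root, so it suffices to search k ≤ depth v.
  Anc? : ∀ z v → Dec (Anc T z v)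
  Anc? z v =
    map′ (λ (k , _ , e) → k , e) bounded
      (anyUpTo? (λ k → iter T k v ≟ z) (suc (depth v)))
    where
    bounded : Anc T z v → ∃[ k ] (k < suc (depth v) × iter T k v ≡ z)
    bounded (k , e) with k ≤? depth v
    ... | yes k≤d = k , s≤s k≤d , e
    ... | no  k≰d =
      depth v , ≤-refl ,
      trans (iter-≥depth v ≤-refl) (trans (sym (iter-≥depth v (≰⇒≥ k≰d))) e)

  commonAnc⇒Anc-parent : ∀ {y w a c} → Anc T y a → Anc T y c →
    Anc T w a → ¬ Anc T w c → Anc T y (parent w)
  commonAnc⇒Anc-parent y≤a y≤c w≤a w≰c with Anc-comparable y≤a w≤a
  ... | inj₂ w≤y = ⊥-elim (w≰c (Anc-trans w≤y y≤c))
  ... | inj₁ y≤w = Anc-≢⇒Anc-parent y≤w λ { refl → w≰c y≤c }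

  commonAnc⇒Anc-edge : ∀ {y w a c} → Anc T y a → Anc T y c →
    Anc T w a → ¬ Anc T w c → Anc T y w
  commonAnc⇒Anc-edge y≤a y≤c w≤a w≰c =
    Anc-trans (commonAnc⇒Anc-parent y≤a y≤c w≤a w≰c) (Anc-parent _)

  OnPath⇒≢root : ∀ {ℓ w} → OnPath T ℓ w → w ≢ root
  OnPath⇒≢root {a , c} (inj₁ (_ , w≰c)) refl = w≰c (Anc-root c)
  OnPath⇒≢root {a , c} (inj₂ (w≰a , _)) refl = w≰a (Anc-root a)

  -- The parent of an edge of P_ℓ lies in V_ℓ and is strictly higher.
  apex-∉-OnPath : ∀ {ℓ x} → IsApex T ℓ x → ¬ OnPath T ℓ x
  apex-∉-OnPath {x = x} (_ , minimal) onPath =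
    <⇒≱ (subst (depth (parent x) <_) (sym (depth-parent x (OnPath⇒≢root onPath))) (n<1+n _))
        (minimal (parent x) (inj₂ (x , onPath , inj₂ refl)))

  InV⇒Anc : ∀ {a c y} → InV T (a , c) y → Anc T y a ⊎ Anc T y c
  InV⇒Anc (inj₁ refl)                                 = inj₁ Anc-refl
  InV⇒Anc (inj₂ (_ , inj₁ (w≤a , _) , inj₁ refl))     = inj₁ w≤a
  InV⇒Anc (inj₂ (_ , inj₂ (_ , w≤c) , inj₁ refl))     = inj₂ w≤c
  InV⇒Anc (inj₂ (w , inj₁ (w≤a , _) , inj₂ refl))     = inj₁ (Anc-trans (Anc-parent w) w≤a)
  InV⇒Anc (inj₂ (w , inj₂ (_ , w≤c) , inj₂ refl))     = inj₂ (Anc-trans (Anc-parent w) w≤c)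

  apex-Anc-ends : ∀ {a c x} → IsApex T (a , c) x → Anc T x a × Anc T x c
  apex-Anc-ends {a} {c} {x} apex with InV⇒Anc (proj₁ apex)
  ... | inj₁ x≤a with Anc? x c
  ...   | yes x≤c = x≤a , x≤c
  ...   | no  x≰c = ⊥-elim (apex-∉-OnPath apex (inj₁ (x≤a , x≰c)))
  apex-Anc-ends {a} {c} {x} apex | inj₂ x≤c with Anc? x a
  ...   | yes x≤a = x≤a , x≤c
  ...   | no  x≰a = ⊥-elim (apex-∉-OnPath apex (inj₂ (x≰a , x≤c)))

  commonAnc⇒Anc-apex : ∀ {a c x y} → IsApex T (a , c) x →
    Anc T y a → Anc T y c → Anc T y x
  commonAnc⇒Anc-apex apex y≤a y≤c with proj₁ apex
  ... | inj₁ refl = y≤a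
  ... | inj₂ (_ , onPath , inj₁ refl) = ⊥-elim (apex-∉-OnPath apex onPath)
  ... | inj₂ (_ , inj₁ (w≤a , w≰c) , inj₂ refl) = commonAnc⇒Anc-parent y≤a y≤c w≤a w≰c
  ... | inj₂ (_ , inj₂ (w≰a , w≤c) , inj₂ refl) = commonAnc⇒Anc-parent y≤c y≤a w≤c w≰a

  apex-Anc-OnPath : ∀ {a c x w} → IsApex T (a , c) x → OnPath T (a , c) w → Anc T x w
  apex-Anc-OnPath apex (inj₁ (w≤a , w≰c)) =
    commonAnc⇒Anc-edge (proj₁ (apex-Anc-ends apex)) (proj₂ (apex-Anc-ends apex)) w≤a w≰c
  apex-Anc-OnPath apex (inj₂ (w≰a , w≤c)) =
    commonAnc⇒Anc-edge (proj₂ (apex-Anc-ends apex)) (proj₁ (apex-Anc-ends apex)) w≤c w≰a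

  Anc-OnPath-∉-OnPath⇒Anc-apex : ∀ {a c x e e′} → IsApex T (a , c) x →
    OnPath T (a , c) e′ → Anc T e e′ → ¬ OnPath T (a , c) e → Anc T e x
  Anc-OnPath-∉-OnPath⇒Anc-apex {a} {c} {e = e} apex (inj₁ (e′≤a , _)) e≤e′ e∉ℓ
    with Anc? e c
  ... | yes e≤c = commonAnc⇒Anc-apex apex (Anc-trans e≤e′ e′≤a) e≤c
  ... | no  e≰c = ⊥-elim (e∉ℓ (inj₁ (Anc-trans e≤e′ e′≤a , e≰c)))
  Anc-OnPath-∉-OnPath⇒Anc-apex {a} {c} {e = e} apex (inj₂ (_ , e′≤c)) e≤e′ e∉ℓ
    with Anc? e a
  ... | yes e≤a = commonAnc⇒Anc-apex apex e≤a (Anc-trans e≤e′ e′≤c)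
  ... | no  e≰a = ⊥-elim (e∉ℓ (inj₂ (e≰a , Anc-trans e≤e′ e′≤c)))

  OnPath-up : ∀ {t b w} → Anc T t b → OnPath T (t , b) w → Anc T w b × ¬ Anc T w t
  OnPath-up t≤b (inj₁ (w≤t , w≰b)) = ⊥-elim (w≰b (Anc-trans w≤t t≤b))
  OnPath-up t≤b (inj₂ (w≰t , w≤b)) = w≤b , w≰t

  OnPath-up-depth-<⇒Anc : ∀ {t b e e′} → Anc T t b →
    OnPath T (t , b) e → OnPath T (t , b) e′ → depth e < depth e′ → Anc T e e′
  OnPath-up-depth-<⇒Anc t≤b onPath onPath′ d<d′
    with Anc-comparable (proj₁ (OnPath-up t≤b onPath)) (proj₁ (OnPath-up t≤b onPath′))
  ... | inj₁ e≤e′ = e≤e′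
  ... | inj₂ e′≤e = ⊥-elim (<⇒≱ d<d′ (Anc⇒depth-≤ e′≤e))

  MinimalCover : LinkSet n → Link n → Set₁
  MinimalCover Fu u =
    ∀ (S : LinkSet n) → (∀ ℓ → S ℓ → Fu ℓ) → CoversPath T S u → ∀ ℓ → Fu ℓ → S ℓ

  -- Without a private edge, Fu ∖ {ℓ} would still cover P_u.
  private-edge-exists : ∀ {Fu u ℓ} → MinimalCover Fu u → Fu ℓ →
    ¬ ¬ ∃ (Private T Fu u ℓ)
  private-edge-exists {Fu} {u} {ℓ} minimal Fuℓ noPrivate =
    ¬¬-∀-Fin (λ w → ¬¬-→ (otherLink w)) λ covers →
      proj₂ (minimal (λ ℓ′ → Fu ℓ′ × ℓ′ ≢ ℓ) (λ _ → proj₁) covers ℓ Fuℓ) refl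
    where
    otherLink : ∀ w → OnPath T u w → ¬ ¬ (∃[ ℓ′ ] ((Fu ℓ′ × ℓ′ ≢ ℓ) × OnPath T ℓ′ w))
    otherLink w onPath none =
      noPrivate (w , onPath , λ ℓ′ Fuℓ′ ℓ′≢ℓ onPath′ → none (ℓ′ , (Fuℓ′ , ℓ′≢ℓ) , onPath′))

  Private⇒OnPath : ∀ {Fu u ℓ w} → CoversPath T Fu u → Private T Fu u ℓ w → OnPath T ℓ w
  Private⇒OnPath {ℓ = ℓ} covers (onPath , private′) with covers _ onPath
  ... | ℓ′ , Fuℓ′ , onPath′ with ≡-dec _≟_ _≟_ ℓ′ ℓ
  ...   | yes refl = onPath′
  ...   | no ℓ′≢ℓ  = ⊥-elim (private′ ℓ′ Fuℓ′ ℓ′≢ℓ onPath′)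

  Prec⇒≢ : ∀ {Fu u ℓ₁ ℓ₂ e} → Private T Fu u ℓ₁ e → Prec T Fu u ℓ₁ ℓ₂ → ℓ₁ ≢ ℓ₂
  Prec⇒≢ p ℓ₁≺ℓ₂ refl = <-irrefl refl (ℓ₁≺ℓ₂ _ _ p p)

  Prec⇒private-Anc-apex : ∀ {Fu t b ℓ₁ a c x e₁ e₂} → Anc T t b →
    CoversPath T Fu (t , b) → Fu (a , c) → Prec T Fu (t , b) ℓ₁ (a , c) →
    IsApex T (a , c) x →
    Private T Fu (t , b) ℓ₁ e₁ → Private T Fu (t , b) (a , c) e₂ → Anc T e₁ x
  Prec⇒private-Anc-apex t≤b covers Fuℓ₂ ℓ₁≺ℓ₂ apex p₁ p₂ =
    Anc-OnPath-∉-OnPath⇒Anc-apex apex (Private⇒OnPath covers p₂)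
      (OnPath-up-depth-<⇒Anc t≤b (proj₁ p₁) (proj₁ p₂) (ℓ₁≺ℓ₂ _ _ p₁ p₂))
      (proj₂ p₁ _ Fuℓ₂ (≢-sym (Prec⇒≢ p₁ ℓ₁≺ℓ₂)))

lemma8 : ∀ {n} (T : RootedTree n) (L F : LinkSet n) →
    (∀ ℓ → L ℓ → proj₁ ℓ ≢ proj₂ ℓ) →
    (∀ ℓ → F ℓ → L ℓ) →
    CoversTree T F →
    (t b : Fin n) → L (t , b) → Anc T t b →
    (v : Fin n) → IsVu T F t b v →
    (Fu : LinkSet n) → IsFu T F t b v Fu →
    (ℓ₁ ℓ₂ : Link n) → InA T Fu (t , b) ℓ₁ ℓ₂ →
    (x : Fin n) → IsApex T ℓ₂ x → x ≢ RootedTree.root T →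
    OnPath T (t , b) x
lemma8 T _ _ _ _ _ t b _ t≤b _ _ Fu (_ , covers , minimal)
       ℓ₁ ℓ₂ (Fuℓ₁ , Fuℓ₂ , ℓ₁≺ℓ₂ , _) x apex _ =
  inj₂ (x≰t , x≤b)
  where
  x≤b : Anc T x b
  x≤b = decidable-stable (Anc? T x b) (¬¬-map below (private-edge-exists T minimal Fuℓ₂))
    where
    below : ∃ (Private T Fu (t , b) ℓ₂) → Anc T x b
    below (_ , p₂) =
      Anc-trans T (apex-Anc-OnPath T apex (Private⇒OnPath T covers p₂))
                  (proj₁ (OnPath-up T t≤b (proj₁ p₂)))

  x≰t : ¬ Anc T x t
  x≰t x≤t =
    private-edge-exists T minimal Fuℓ₁ λ (_ , p₁) →
    private-edge-exists T minimal Fuℓ₂ λ (_ , p₂) →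
    proj₂ (OnPath-up T t≤b (proj₁ p₁))
      (Anc-trans T (Prec⇒private-Anc-apex T t≤b covers Fuℓ₂ ℓ₁≺ℓ₂ apex p₁ p₂) x≤t)
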